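{- Let $\lambda=(\lambda_1\ge\lambda_2\ge\dots\ge\lambda_\ell>0)$ be a partition of $n$, and let $K$ be a field of characteristic zero. Suppose $f(x_1,\dots,x_n)=\sum_{t}c_t\,\Delta^x_t$, the sum over all standard tableaux $t$ of shape $\lambda$, with coefficients $c_t\in K$ independent of $x_1,\dots,x_n$. Then $\Delta^x_\aleph(\aleph)\neq 0$ and $$c_\aleph=\frac{f(\aleph)}{\Delta^x_\aleph(\aleph)}.$$
   Context: Diagrams are drawn in French convention: rows are numbered $0,1,2,\dots$ from the bottom, row $r$ having length $\lambda_{r+1}$. A standard tableau of shape $\lambda$ is a bijective filling of the diagram with $1,\dots,n$ increasing left to right along rows and bottom to top along columns. For a standard tableau $t$, its Specht polynomial is $\Delta^x_t=\prod_{\text{columns}}\prod_{p<q}(x_{c_p}-x_{c_q})$, where $c_1,c_2,\dots$ are the entries of the column read from bottom to top. $\aleph$ denotes the standard tableau of shape $\lambda$ whose rows are filled with consecutive integers: row $0$ contains $1,\dots,\lambda_1$, row $1$ contains $\lambda_1+1,\dots,\lambda_1+\lambda_2$, and so on. For a function $g(x_1,\dots,x_n)$ and a tableau $t$, $g(t)$ denotes the value of $g$ at $x_i=r$, where $r$ is the index of the row of $t$ containing $i$. -}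

module Defs where

open import Level using (Level; _⊔_) renaming (suc to lsuc)
open import Algebra.Bundles using (CommutativeRing)
open import Data.Nat as ℕ using (ℕ; zero; suc; _<_; _≥_)
open import Data.List using (List; []; _∷_; map; length; concat; upTo; foldr; mapMaybe)
open import Data.Nat.ListAction using (sum)
open import Data.Bool using (true; false)
open import Data.Bool.ListAction using (any)
open import Data.List.Relation.Unary.All using (All)
open import Data.List.Relation.Unary.Linked using (Linked)
open import Data.List.Relation.Binary.Permutation.Propositional using (_↭_)
open import Data.Maybe using (Maybe; just; nothing)
open import Data.Product using (_×_)
open import Relation.Nullary using (¬_)
open import Relation.Binary.PropositionalEquality using (_≡_)

record Field (c ℓ : Level) : Set (lsuc (c ⊔ ℓ)) where
  field
    commutativeRing : CommutativeRing c ℓ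
  open CommutativeRing commutativeRing public
  field
    1≉0     : ¬ (1# ≈ 0#)
    inv     : (x : Carrier) → ¬ (x ≈ 0#) → Carrier
    inverse : (x : Carrier) (nz : ¬ (x ≈ 0#)) → x * inv x nz ≈ 1#

module _ {c ℓ : Level} (K : Field c ℓ) where
  open Field K

  fromℕ : ℕ → Carrier
  fromℕ zero    = 0#
  fromℕ (suc m) = 1# + fromℕ m

  CharZero : Set ℓ
  CharZero = (m : ℕ) → ¬ (fromℕ (suc m) ≈ 0#)

IsPartition : ℕ → List ℕ → Set
IsPartition n shape = (sum shape ≡ n) × All (0 <_) shape × Linked _≥_ shape

-- A (candidate) tableau is the list of its rows, row 0 (bottom) first,
-- each row listed left to right.
Tableau : Set
Tableau = List (List ℕ)

lookupℕ : {A : Set} → List A → ℕ → Maybe A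
lookupℕ []       _       = nothing
lookupℕ (a ∷ as) zero    = just a
lookupℕ (a ∷ as) (suc k) = lookupℕ as k

-- entry in row r, column j (both counted from 0)
entry : Tableau → ℕ → ℕ → Maybe ℕ
entry t r j with lookupℕ t r
... | nothing  = nothing
... | just row = lookupℕ row j

IsStandard : List ℕ → Tableau → Set
IsStandard shape t =
  (map length t ≡ shape) ×
  (concat t ↭ map suc (upTo (sum shape))) ×
  (∀ r j a b → entry t r j ≡ just a → entry t r (suc j) ≡ just b → a < b) ×
  (∀ r j a b → entry t r j ≡ just a → entry t (suc r) j ≡ just b → a < b)

alephFrom : ℕ → List ℕ → Tableau
alephFrom s []           = []
alephFrom s (l ∷ shape)  = map (λ k → s ℕ.+ suc k) (upTo l) ∷ alephFrom (s ℕ.+ l) shape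

aleph : List ℕ → Tableau
aleph shape = alephFrom 0 shape

-- index of the row of t containing i (0 if i does not occur)
rowOfFrom : ℕ → Tableau → ℕ → ℕ
rowOfFrom r []         i = 0
rowOfFrom r (row ∷ t)  i with any (λ a → a ℕ.≡ᵇ i) row
... | true  = r
... | false = rowOfFrom (suc r) t i

rowOf : Tableau → ℕ → ℕ
rowOf t i = rowOfFrom 0 t i

column : Tableau → ℕ → List ℕ
column t j = mapMaybe (λ row → lookupℕ row j) t

numColumns : Tableau → ℕ
numColumns t = foldr ℕ._⊔_ 0 (map length t)

module _ {c ℓ : Level} (K : Field c ℓ) where
  open Field K

  prodK : List Carrier → Carrier
  prodK = foldr _*_ 1#

  sumK : List Carrier → Carrier
  sumK = foldr _+_ 0#

  vandermonde : (ℕ → Carrier) → List ℕ → Carrier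
  vandermonde x []       = 1#
  vandermonde x (a ∷ cs) = prodK (map (λ b → x a - x b) cs) * vandermonde x cs

  -- Specht polynomial Δ^x_t, as a function of the variables x₁, x₂, ...
  -- (x i is the value of the variable x_i)
  specht : Tableau → (ℕ → Carrier) → Carrier
  specht t x = prodK (map (λ j → vandermonde x (column t j)) (upTo (numColumns t)))

  atTableau : Tableau → (ℕ → Carrier)
  atTableau t i = fromℕ K (rowOf t i)

{-# OPTIONS --safe #-}

-- At the point x_i = (row of i in ℵ) the factor x_a - x_b of a Specht polynomial vanishes
-- exactly when a and b lie in the same row of ℵ, so in characteristic zero Δ_t(ℵ) ≠ 0 iff
-- no column of t holds two entries of one row of ℵ. Among the standard tableaux of shape λ
-- only ℵ itself has this property, so f(ℵ) = c_ℵ Δ_ℵ(ℵ) with Δ_ℵ(ℵ) ≠ 0.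

module Submission where

open import Defs
open import Data.Nat
  using (ℕ; zero; suc; _+_; _<_; _≥_; _<′_; _≡ᵇ_; _≟_; z<s; s<s; <′-base; <′-step)
import Data.Nat.Properties as ℕ
open import Data.Nat.Induction using (<-rec)
open import Data.Nat.ListAction using (sum)
open import Data.Bool using (true; false; T)
open import Data.Bool.ListAction using (any)
open import Data.List using (List; []; _∷_; map; length; concat; upTo; applyUpTo; _++_)
open import Data.List.Properties using (length-map; length-upTo; map-upTo; ∷-injective)
open import Data.List.Membership.Propositional using (_∈_)
open import Data.List.Membership.Propositional.Properties
  using (∈-++⁺ˡ; ∈-++⁺ʳ; ∈-++⁻; ∈-upTo⁺; ∈-upTo⁻)
open import Data.List.Relation.Unary.Any as Any using (here; there)
open import Data.List.Relation.Unary.Any.Properties using (any⁺; any⁻)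
open import Data.List.Relation.Unary.All as All using (All; []; _∷_)
open import Data.List.Relation.Unary.All.Properties using (++⁻ˡ; ++⁻ʳ)
open import Data.List.Relation.Unary.AllPairs using (AllPairs; []; _∷_)
open import Data.List.Relation.Unary.Linked using (Linked; _∷_)
open import Data.List.Relation.Unary.Unique.Propositional using (Unique)
import Data.List.Relation.Unary.Unique.Propositional.Properties as Unique
open import Data.List.Relation.Binary.Disjoint.Propositional using (Disjoint)
open import Data.List.Relation.Binary.Permutation.Propositional using (↭-sym; ↭-reflexive; ↭⇒↭ₛ)
open import Data.List.Relation.Binary.Permutation.Propositional.Properties using (∈-resp-↭)
open import Data.Maybe using (just; nothing)
open import Data.Maybe.Properties using (just-injective)
open import Data.Product using (Σ; _×_; _,_; proj₁; proj₂; ∃; ∃₂)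
open import Data.Product.Relation.Binary.Lex.Strict using (×-Lex; ×-compare)
open import Data.Sum using (_⊎_; inj₁; inj₂)
open import Data.Empty using (⊥-elim)
open import Function using (_∘_; _on_)
open import Function.Bundles using (_⇔_; Equivalence)
open import Relation.Nullary using (¬_; yes; no; contradiction)
open import Relation.Binary.Definitions using (tri<; tri≈; tri>)
open import Relation.Binary.PropositionalEquality
open import Data.List.Relation.Binary.Permutation.Setoid.Properties (setoid ℕ) using (Unique-resp-↭)
import Algebra.Properties.Group as GroupProperties
import Relation.Binary.Reasoning.Setoid as SetoidReasoning

module _ {A : Set} where

  lookupℕ-< : ∀ xs {j} {v : A} → lookupℕ xs j ≡ just v → j < length xs
  lookupℕ-< (x ∷ xs) {zero}  _ = z<s
  lookupℕ-< (x ∷ xs) {suc j} e = s<s (lookupℕ-< xs e)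

  lookupℕ-total : ∀ xs {j} → j < length xs → ∃ λ (v : A) → lookupℕ xs j ≡ just v
  lookupℕ-total (x ∷ xs) {zero}  _         = x , refl
  lookupℕ-total (x ∷ xs) {suc j} (s<s j<n) = lookupℕ-total xs j<n

  lookupℕ-∈ : ∀ xs {j} {v : A} → lookupℕ xs j ≡ just v → v ∈ xs
  lookupℕ-∈ (x ∷ xs) {zero}  refl = here refl
  lookupℕ-∈ (x ∷ xs) {suc j} e    = there (lookupℕ-∈ xs e)

  ∈⇒lookupℕ : ∀ {xs} {v : A} → v ∈ xs → ∃ λ j → lookupℕ xs j ≡ just v
  ∈⇒lookupℕ (here refl) = zero , refl
  ∈⇒lookupℕ (there v∈xs) with ∈⇒lookupℕ v∈xs
  ... | j , e = suc j , e

  lookupℕ-injective : ∀ xs {j j′} {v : A} → Unique xs →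
                      lookupℕ xs j ≡ just v → lookupℕ xs j′ ≡ just v → j ≡ j′
  lookupℕ-injective (x ∷ xs) {zero}  {zero}   _          _    _  = refl
  lookupℕ-injective (x ∷ xs) {zero}  {suc j′} (x∉ ∷ _)   refl e′ =
    ⊥-elim (All.lookup x∉ (lookupℕ-∈ xs e′) refl)
  lookupℕ-injective (x ∷ xs) {suc j} {zero}   (x∉ ∷ _)   e refl  =
    ⊥-elim (All.lookup x∉ (lookupℕ-∈ xs e) refl)
  lookupℕ-injective (x ∷ xs) {suc j} {suc j′} (_ ∷ uniq) e e′    =
    cong suc (lookupℕ-injective xs uniq e e′)

  lookupℕ-applyUpTo : ∀ (f : ℕ → A) l {j v} →
                      lookupℕ (applyUpTo f l) j ≡ just v → v ≡ f j × j < l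
  lookupℕ-applyUpTo f (suc l) {zero}  refl = refl , z<s
  lookupℕ-applyUpTo f (suc l) {suc j} e with lookupℕ-applyUpTo (f ∘ suc) l e
  ... | v≡f[1+j] , j<l = v≡f[1+j] , s<s j<l

  lookupℕ-ext : ∀ (xs ys : List A) → length xs ≡ length ys →
                (∀ j {v} → lookupℕ ys j ≡ just v → lookupℕ xs j ≡ just v) → xs ≡ ys
  lookupℕ-ext []       []       _   _   = refl
  lookupℕ-ext (x ∷ xs) (y ∷ ys) len ys⊆xs =
    cong₂ _∷_ (just-injective (ys⊆xs zero refl))
              (lookupℕ-ext xs ys (ℕ.suc-injective len) (λ j → ys⊆xs (suc j)))

  applyUpTo-+ : ∀ (f : ℕ → A) m n →
                applyUpTo f (m + n) ≡ applyUpTo f m ++ applyUpTo (f ∘ (m +_)) n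
  applyUpTo-+ f zero    n = refl
  applyUpTo-+ f (suc m) n = cong (f 0 ∷_) (applyUpTo-+ (f ∘ suc) m n)

  applyUpTo-cong : ∀ {f g : ℕ → A} → (∀ k → f k ≡ g k) →
                   ∀ n → applyUpTo f n ≡ applyUpTo g n
  applyUpTo-cong f≗g zero    = refl
  applyUpTo-cong f≗g (suc n) = cong₂ _∷_ (f≗g 0) (applyUpTo-cong (f≗g ∘ suc) n)

  Unique-++⁻ˡ : ∀ xs {ys : List A} → Unique (xs ++ ys) → Unique xs
  Unique-++⁻ˡ []       _           = []
  Unique-++⁻ˡ (x ∷ xs) (x∉ ∷ uniq) = ++⁻ˡ xs x∉ ∷ Unique-++⁻ˡ xs uniq

  Unique-++⁻ʳ : ∀ xs {ys : List A} → Unique (xs ++ ys) → Unique ys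
  Unique-++⁻ʳ []       uniq       = uniq
  Unique-++⁻ʳ (x ∷ xs) (_ ∷ uniq) = Unique-++⁻ʳ xs uniq

  Unique-++⇒Disjoint : ∀ xs {ys : List A} → Unique (xs ++ ys) → Disjoint xs ys
  Unique-++⇒Disjoint (x ∷ xs) (x∉ ∷ _)   (here refl , v∈ys)   =
    All.lookup (++⁻ʳ xs x∉) v∈ys refl
  Unique-++⇒Disjoint (x ∷ xs) (_ ∷ uniq) (there v∈xs , v∈ys) =
    Unique-++⇒Disjoint xs uniq (v∈xs , v∈ys)

∈⇒any-≡ᵇ : ∀ {v xs} → v ∈ xs → T (any (λ a → a ≡ᵇ v) xs)
∈⇒any-≡ᵇ v∈xs = any⁺ _ (Any.map (λ v≡a → ℕ.≡⇒≡ᵇ _ _ (sym v≡a)) v∈xs)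

any-≡ᵇ⇒∈ : ∀ {v} xs → T (any (λ a → a ≡ᵇ v) xs) → v ∈ xs
any-≡ᵇ⇒∈ xs found = Any.map (λ a≡ᵇv → sym (ℕ.≡ᵇ⇒≡ _ _ a≡ᵇv)) (any⁻ _ xs found)

-- Tableaux

entry-∈ : ∀ t {r j v} → entry t r j ≡ just v → v ∈ concat t
entry-∈ (row ∷ t) {zero}  e = ∈-++⁺ˡ (lookupℕ-∈ row e)
entry-∈ (row ∷ t) {suc r} e = ∈-++⁺ʳ row (entry-∈ t e)

∈⇒entry : ∀ t {v} → v ∈ concat t → ∃₂ λ r j → entry t r j ≡ just v
∈⇒entry (row ∷ t) v∈t with ∈-++⁻ row v∈t
... | inj₁ v∈row = let j , e = ∈⇒lookupℕ v∈row in zero , j , e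
... | inj₂ v∈t′  = let r , j , e = ∈⇒entry t v∈t′ in suc r , j , e

entry-injective : ∀ t {r j r′ j′ v} → Unique (concat t) →
                  entry t r j ≡ just v → entry t r′ j′ ≡ just v → r ≡ r′ × j ≡ j′
entry-injective (row ∷ t) {zero}  {r′ = zero}   uniq e e′ =
  refl , lookupℕ-injective row (Unique-++⁻ˡ row uniq) e e′
entry-injective (row ∷ t) {zero}  {r′ = suc r′} uniq e e′ =
  ⊥-elim (Unique-++⇒Disjoint row uniq (lookupℕ-∈ row e , entry-∈ t e′))
entry-injective (row ∷ t) {suc r} {r′ = zero}   uniq e e′ =
  ⊥-elim (Unique-++⇒Disjoint row uniq (lookupℕ-∈ row e′ , entry-∈ t e))
entry-injective (row ∷ t) {suc r} {r′ = suc r′} uniq e e′ =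
  let r≡r′ , j≡j′ = entry-injective t (Unique-++⁻ʳ row uniq) e e′
  in cong suc r≡r′ , j≡j′

rowOfFrom-entry : ∀ s t {r j v} → Unique (concat t) →
                  entry t r j ≡ just v → rowOfFrom s t v ≡ s + r
rowOfFrom-entry s (row ∷ t) {zero} {v = v} _ e
  with any (λ a → a ≡ᵇ v) row | ∈⇒any-≡ᵇ (lookupℕ-∈ row e)
... | true  | _  = sym (ℕ.+-identityʳ s)
... | false | ()
rowOfFrom-entry s (row ∷ t) {suc r} {v = v} uniq e
  with any (λ a → a ≡ᵇ v) row | any-≡ᵇ⇒∈ {v} row
... | true  | v∈row = ⊥-elim (Unique-++⇒Disjoint row uniq (v∈row _ , entry-∈ t e))
... | false | _     =
  trans (rowOfFrom-entry (suc s) t (Unique-++⁻ʳ row uniq) e) (sym (ℕ.+-suc s r))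

rowOf-entry : ∀ t {r j v} → Unique (concat t) → entry t r j ≡ just v → rowOf t v ≡ r
rowOf-entry = rowOfFrom-entry 0

entry-sameShape : ∀ t t′ {r j v} → map length t ≡ map length t′ →
                  entry t r j ≡ just v → ∃ λ w → entry t′ r j ≡ just w
entry-sameShape (row ∷ t) (row′ ∷ t′) {zero}  shape e =
  lookupℕ-total row′ (subst (_ <_) (proj₁ (∷-injective shape)) (lookupℕ-< row e))
entry-sameShape (row ∷ t) (row′ ∷ t′) {suc r} shape e =
  entry-sameShape t t′ (proj₂ (∷-injective shape)) e

tableau-ext : ∀ t t′ → map length t ≡ map length t′ →
              (∀ r j {v} → entry t′ r j ≡ just v → entry t r j ≡ just v) → t ≡ t′
tableau-ext []        []          _     _     = refl
tableau-ext (row ∷ t) (row′ ∷ t′) shape t′⊆t =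
  cong₂ _∷_ (lookupℕ-ext row row′ (proj₁ (∷-injective shape)) (t′⊆t zero))
            (tableau-ext t t′ (proj₂ (∷-injective shape)) (λ r → t′⊆t (suc r)))

∈-column⁻ : ∀ t {j b} → b ∈ column t j → ∃ λ i → entry t i j ≡ just b
∈-column⁻ (row ∷ t) {j} b∈ with lookupℕ row j in eq
∈-column⁻ (row ∷ t) (here refl) | just _  = zero , eq
∈-column⁻ (row ∷ t) (there b∈)  | just _  = let i , e = ∈-column⁻ t b∈ in suc i , e
∈-column⁻ (row ∷ t) b∈          | nothing = let i , e = ∈-column⁻ t b∈ in suc i , e

AllPairs-column⁺ : ∀ {R : ℕ → ℕ → Set} t {j} →
                   (∀ {i i′ u v} → i < i′ →
                      entry t i j ≡ just u → entry t i′ j ≡ just v → R u v) →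
                   AllPairs R (column t j)
AllPairs-column⁺ []        _     = []
AllPairs-column⁺ (row ∷ t) {j} above with lookupℕ row j in eq
... | just _  = All.tabulate (λ b∈ → above z<s eq (proj₂ (∈-column⁻ t b∈)))
              ∷ AllPairs-column⁺ t (above ∘ s<s)
... | nothing = AllPairs-column⁺ t (above ∘ s<s)

∈-column⁺ : ∀ t {i j b} → entry t i j ≡ just b → b ∈ column t j
∈-column⁺ (row ∷ t) {zero}  {j} e with lookupℕ row j
∈-column⁺ (row ∷ t) {zero}  {j} refl | just _ = here refl
∈-column⁺ (row ∷ t) {suc i} {j} e with lookupℕ row j
... | just _  = there (∈-column⁺ t e)
... | nothing = ∈-column⁺ t e

AllPairs-column⁻ : ∀ {R : ℕ → ℕ → Set} t {j i i′ u v} → AllPairs R (column t j) →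
                   i < i′ → entry t i j ≡ just u → entry t i′ j ≡ just v → R u v
AllPairs-column⁻ (row ∷ t) {j} {zero} {suc i′} pairs _ e e′ with lookupℕ row j
AllPairs-column⁻ (row ∷ t) {j} {zero} {suc i′} (u∼ ∷ _) _ refl e′ | just _ =
  All.lookup u∼ (∈-column⁺ t e′)
AllPairs-column⁻ (row ∷ t) {j} {suc i} {suc i′} pairs (s<s i<i′) e e′
  with lookupℕ row j | pairs
... | just _  | _ ∷ pairs′ = AllPairs-column⁻ t pairs′ i<i′ e e′
... | nothing | pairs′     = AllPairs-column⁻ t pairs′ i<i′ e e′

AllColumnPairs : (ℕ → ℕ → Set) → Tableau → Set
AllColumnPairs R t = ∀ j → j < numColumns t → AllPairs R (column t j)

entry-numColumns : ∀ t {i j u} → entry t i j ≡ just u → j < numColumns t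
entry-numColumns (row ∷ t) {zero}  e = ℕ.<-≤-trans (lookupℕ-< row e) (ℕ.m≤m⊔n _ _)
entry-numColumns (row ∷ t) {suc i} e =
  ℕ.<-≤-trans (entry-numColumns t e) (ℕ.m≤n⊔m (length row) _)

rowOf-separatesColumns : ∀ t → Unique (concat t) → AllColumnPairs (_≢_ on rowOf t) t
rowOf-separatesColumns t uniq _ _ = AllPairs-column⁺ t λ i<i′ e e′ same →
  ℕ.<⇒≢ i<i′ (trans (sym (rowOf-entry t uniq e)) (trans same (rowOf-entry t uniq e′)))

RowsIncrease ColumnsIncrease : Tableau → Set
RowsIncrease    t = ∀ r j a b → entry t r j ≡ just a → entry t r (suc j) ≡ just b → a < b
ColumnsIncrease t = ∀ r j a b → entry t r j ≡ just a → entry t (suc r) j ≡ just b → a < b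

descend : {P : ℕ → ℕ → Set} → (∀ {j v} → P (suc j) v → ∃ λ w → P j w × w < v) →
          ∀ {k j v} → k <′ j → P j v → ∃ λ u → P k u × u < v
descend step <′-base        p = step p
descend step (<′-step k<j) p with step p
... | w , pw , w<v with descend step k<j pw
... | u , pu , u<w = u , pu , ℕ.<-trans u<w w<v

entry-left : ∀ t {r j v} → entry t r (suc j) ≡ just v → ∃ λ w → entry t r j ≡ just w
entry-left (row ∷ t) {zero}  e = lookupℕ-total row (ℕ.<-trans (ℕ.n<1+n _) (lookupℕ-< row e))
entry-left (row ∷ t) {suc r} e = entry-left t e

entry-below : ∀ t {r j v} → Linked _≥_ (map length t) →
              entry t (suc r) j ≡ just v → ∃ λ w → entry t r j ≡ just w
entry-below (row₀ ∷ row₁ ∷ t) {zero}  (row₀≥row₁ ∷ _) e =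
  lookupℕ-total row₀ (ℕ.<-≤-trans (lookupℕ-< row₁ e) row₀≥row₁)
entry-below (row₀ ∷ row₁ ∷ t) {suc r} (_ ∷ decreasing) e =
  entry-below (row₁ ∷ t) decreasing e

row-< : ∀ t {r j k v} → RowsIncrease t → k < j →
        entry t r j ≡ just v → ∃ λ u → entry t r k ≡ just u × u < v
row-< t {r} increasing k<j = descend step (ℕ.<⇒<′ k<j)
  where
    step : ∀ {j v} → entry t r (suc j) ≡ just v → ∃ λ w → entry t r j ≡ just w × w < v
    step e = let w , e′ = entry-left t e in w , e′ , increasing _ _ _ _ e′ e

column-< : ∀ t {r j i v} → Linked _≥_ (map length t) → ColumnsIncrease t → i < r →
           entry t r j ≡ just v → ∃ λ u → entry t i j ≡ just u × u < v
column-< t {j = j} decreasing increasing i<r = descend step (ℕ.<⇒<′ i<r)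
  where
    step : ∀ {r v} → entry t (suc r) j ≡ just v → ∃ λ w → entry t r j ≡ just w × w < v
    step e = let w , e′ = entry-below t decreasing e in w , e′ , increasing _ _ _ _ e′ e

standard⇒Unique : ∀ {shape t} → IsStandard shape t → Unique (concat t)
standard⇒Unique {shape} (_ , entries , _) =
  Unique-resp-↭ (↭⇒↭ₛ (↭-sym entries))
                (Unique.map⁺ ℕ.suc-injective (Unique.upTo⁺ (sum shape)))

-- The tableau ℵ

_<ₗₑₓ_ : ℕ × ℕ → ℕ × ℕ → Set
_<ₗₑₓ_ = ×-Lex _≡_ _<_ _<_

alephFrom-row : ∀ s l {j w} → lookupℕ (map (λ k → s + suc k) (upTo l)) j ≡ just w →
                w ≡ s + suc j × j < l
alephFrom-row s l e =
  lookupℕ-applyUpTo _ l (subst (λ row → lookupℕ row _ ≡ just _) (map-upTo _ l) e)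

alephFrom-> : ∀ s shape {r j v} → entry (alephFrom s shape) r j ≡ just v → s < v
alephFrom-> s (l ∷ shape) {zero} e with alephFrom-row s l e
... | refl , _ = ℕ.m<m+n s z<s
alephFrom-> s (l ∷ shape) {suc r} e = ℕ.≤-<-trans (ℕ.m≤m+n s l) (alephFrom-> (s + l) shape e)

alephFrom-increasing : ∀ s shape {r j R k w v} → (r , j) <ₗₑₓ (R , k) →
                       entry (alephFrom s shape) r j ≡ just w →
                       entry (alephFrom s shape) R k ≡ just v → w < v
alephFrom-increasing s (l ∷ shape) {zero} {R = zero} (inj₂ (_ , j<k)) e e′
  with alephFrom-row s l e | alephFrom-row s l e′
... | refl , _ | refl , _ = ℕ.+-monoʳ-< s (s<s j<k)
alephFrom-increasing s (l ∷ shape) {zero} {R = suc R} _ e e′ with alephFrom-row s l e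
... | refl , j<l = ℕ.≤-<-trans (ℕ.+-monoʳ-≤ s j<l) (alephFrom-> (s + l) shape e′)
alephFrom-increasing s (l ∷ shape) {suc r} {R = suc R} (inj₁ (s<s r<R)) e e′ =
  alephFrom-increasing (s + l) shape (inj₁ r<R) e e′
alephFrom-increasing s (l ∷ shape) {suc r} {R = suc R} (inj₂ (refl , j<k)) e e′ =
  alephFrom-increasing (s + l) shape (inj₂ (refl , j<k)) e e′

alephFrom-shape : ∀ s shape → map length (alephFrom s shape) ≡ shape
alephFrom-shape s []          = refl
alephFrom-shape s (l ∷ shape) =
  cong₂ _∷_ (trans (length-map _ (upTo l)) (length-upTo l)) (alephFrom-shape (s + l) shape)

alephFrom-concat : ∀ s shape →
                   concat (alephFrom s shape) ≡ applyUpTo (λ k → s + suc k) (sum shape)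
alephFrom-concat s []          = refl
alephFrom-concat s (l ∷ shape) = begin
  map (λ k → s + suc k) (upTo l) ++ concat (alephFrom (s + l) shape)
    ≡⟨ cong₂ _++_ (map-upTo _ l) (alephFrom-concat (s + l) shape) ⟩
  applyUpTo (λ k → s + suc k) l ++ applyUpTo (λ k → s + l + suc k) (sum shape)
    ≡⟨ cong (applyUpTo _ l ++_) (applyUpTo-cong shift (sum shape)) ⟩
  applyUpTo (λ k → s + suc k) l ++ applyUpTo (λ k → s + suc (l + k)) (sum shape)
    ≡⟨ applyUpTo-+ _ l (sum shape) ⟨
  applyUpTo (λ k → s + suc k) (l + sum shape) ∎
  where
    open ≡-Reasoning
    shift : ∀ k → s + l + suc k ≡ s + suc (l + k)
    shift k = trans (ℕ.+-assoc s l (suc k)) (cong (s +_) (ℕ.+-suc l k))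

aleph-standard : ∀ shape → IsStandard shape (aleph shape)
aleph-standard shape =
  alephFrom-shape 0 shape ,
  ↭-reflexive (trans (alephFrom-concat 0 shape) (sym (map-upTo suc (sum shape)))) ,
  (λ r j _ _ → alephFrom-increasing 0 shape (inj₂ (refl , ℕ.n<1+n j))) ,
  (λ r j _ _ → alephFrom-increasing 0 shape (inj₁ (ℕ.n<1+n r)))

standard-∈ : ∀ {shape t t′ v} → IsStandard shape t → IsStandard shape t′ →
             v ∈ concat t → v ∈ concat t′
standard-∈ (_ , entries , _) (_ , entries′ , _) = ∈-resp-↭ (↭-sym entries′) ∘ ∈-resp-↭ entries

-- Strong induction on v, whose place in ℵ is (R, k): every u < v already sits in t where it
-- sits in ℵ. A cell of t lexicographically before (R, k) holds a smaller entry of ℵ; if v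
-- were to the right of (R, k), t would hold some u < v at (R, k); if v were in a row above R,
-- the entry u < v below it in row R of t would lie in row R of ℵ, like v.
standard≡aleph : ∀ {n shape t} → IsPartition n shape → IsStandard shape t →
                 AllColumnPairs (_≢_ on rowOf (aleph shape)) t → t ≡ aleph shape
standard≡aleph {shape = shape} {t} (_ , _ , decreasing)
               t-std@(t-shape , _ , t-rows , t-columns) separated =
  tableau-ext t ℵ same-shape (λ R k → <-rec Placed placed _ R k)
  where
    ℵ : Tableau
    ℵ = aleph shape

    ℵ-std : IsStandard shape ℵ
    ℵ-std = aleph-standard shape

    same-shape : map length t ≡ map length ℵ
    same-shape = trans t-shape (sym (proj₁ ℵ-std))

    decreasing-t : Linked _≥_ (map length t)
    decreasing-t = subst (Linked _≥_) (sym t-shape) decreasing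

    Placed : ℕ → Set
    Placed v = ∀ R k → entry ℵ R k ≡ just v → entry t R k ≡ just v

    placed-back : ∀ {u p q} → Placed u → entry t p q ≡ just u → entry ℵ p q ≡ just u
    placed-back placed-u e with ∈⇒entry ℵ (standard-∈ t-std ℵ-std (entry-∈ t e))
    ... | R , k , eℵ with entry-injective t (standard⇒Unique t-std) (placed-u R k eℵ) e
    ... | refl , refl = eℵ

    placed : ∀ v → (∀ {u} → u < v → Placed u) → Placed v
    placed v ih R k ℵ[R,k] with ∈⇒entry t (standard-∈ ℵ-std t-std (entry-∈ ℵ ℵ[R,k]))
    ... | r , j , t[r,j] with ×-compare sym ℕ.<-cmp ℕ.<-cmp (r , j) (R , k)
    ... | tri≈ _ (refl , refl) _ = t[r,j]
    ... | tri< earlier _ _ =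
      let w , ℵ[r,j] = entry-sameShape t ℵ same-shape t[r,j]
          w<v = alephFrom-increasing 0 shape earlier ℵ[r,j] ℵ[R,k]
      in contradiction (just-injective (trans (sym (ih w<v r j ℵ[r,j])) t[r,j])) (ℕ.<⇒≢ w<v)
    ... | tri> _ _ (inj₂ (refl , k<j)) =
      let u , t[R,k] , u<v = row-< t t-rows k<j t[r,j]
          ℵ[R,k]≡u = placed-back (ih u<v) t[R,k]
      in contradiction (just-injective (trans (sym ℵ[R,k]≡u) ℵ[R,k])) (ℕ.<⇒≢ u<v)
    ... | tri> _ _ (inj₁ R<r) =
      let u , t[R,j] , u<v = column-< t decreasing-t t-columns R<r t[r,j]
          ℵ-unique = standard⇒Unique ℵ-std
          sameRow = trans (rowOf-entry ℵ ℵ-unique (placed-back (ih u<v) t[R,j]))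
                          (sym (rowOf-entry ℵ ℵ-unique ℵ[R,k]))
          column-j = separated j (entry-numColumns t t[r,j])
      in ⊥-elim (AllPairs-column⁻ t column-j R<r t[R,j] t[r,j] sameRow)

-- Evaluating Specht polynomials in a field

module _ {c ℓ} (K : Field c ℓ) where
  open Field K renaming (refl to ≈-refl; sym to ≈-sym; trans to ≈-trans; setoid to ≈-setoid)
  open SetoidReasoning ≈-setoid
  private module +-Group = GroupProperties +-group

  *-≉0 : ∀ {a b} → a ≉ 0# → b ≉ 0# → a * b ≉ 0#
  *-≉0 {a} {b} a≉0 b≉0 ab≈0 = b≉0 (begin
    b                   ≈⟨ *-identityˡ b ⟨
    1# * b              ≈⟨ *-congʳ (≈-trans (*-comm _ _) (inverse a a≉0)) ⟨
    (inv a a≉0 * a) * b ≈⟨ *-assoc _ _ _ ⟩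
    inv a a≉0 * (a * b) ≈⟨ *-congˡ ab≈0 ⟩
    inv a a≉0 * 0#      ≈⟨ zeroʳ _ ⟩
    0#                  ∎)

  ≈*inv : ∀ {a b d} → a * d ≈ b → (d≉0 : d ≉ 0#) → a ≈ b * inv d d≉0
  ≈*inv {a} {b} {d} ad≈b d≉0 = begin
    a                   ≈⟨ *-identityʳ a ⟨
    a * 1#              ≈⟨ *-congˡ (inverse d d≉0) ⟨
    a * (d * inv d d≉0) ≈⟨ *-assoc _ _ _ ⟨
    a * d * inv d d≉0   ≈⟨ *-congʳ ad≈b ⟩
    b * inv d d≉0       ∎

  module _ {A : Set} (g : A → Carrier) where

    prodK-≉0 : ∀ {xs} → All (λ a → g a ≉ 0#) xs → prodK K (map g xs) ≉ 0#
    prodK-≉0 []             = 1≉0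
    prodK-≉0 (ga≉0 ∷ gas≉0) = *-≉0 ga≉0 (prodK-≉0 gas≉0)

    prodK-≈0⊎All : ∀ {Q : A → Set} → (∀ a → g a ≈ 0# ⊎ Q a) →
                   ∀ xs → prodK K (map g xs) ≈ 0# ⊎ All Q xs
    prodK-≈0⊎All dichotomy []       = inj₂ []
    prodK-≈0⊎All dichotomy (a ∷ xs) with dichotomy a | prodK-≈0⊎All dichotomy xs
    ... | inj₁ ga≈0 | _           = inj₁ (≈-trans (*-congʳ ga≈0) (zeroˡ _))
    ... | inj₂ _    | inj₁ gas≈0  = inj₁ (≈-trans (*-congˡ gas≈0) (zeroʳ _))
    ... | inj₂ qa   | inj₂ qas    = inj₂ (qa ∷ qas)

    sumK-≈0 : ∀ {xs} → All (λ a → g a ≈ 0#) xs → sumK K (map g xs) ≈ 0#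
    sumK-≈0 []             = ≈-refl
    sumK-≈0 (ga≈0 ∷ gas≈0) = ≈-trans (+-cong ga≈0 (sumK-≈0 gas≈0)) (+-identityˡ 0#)

    sumK-single : ∀ {a xs} → Unique xs → a ∈ xs → (∀ {b} → b ∈ xs → b ≡ a ⊎ g b ≈ 0#) →
                  sumK K (map g xs) ≈ g a
    sumK-single {xs = x ∷ xs} (x∉ ∷ _) (here refl) others =
      ≈-trans (+-congˡ (sumK-≈0 (All.tabulate rest≈0))) (+-identityʳ (g x))
      where
        rest≈0 : ∀ {b} → b ∈ xs → g b ≈ 0#
        rest≈0 b∈xs with others (there b∈xs)
        ... | inj₁ refl = contradiction refl (All.lookup x∉ b∈xs)
        ... | inj₂ gb≈0 = gb≈0
    sumK-single {xs = x ∷ xs} (x∉ ∷ uniq) (there a∈xs) others with others (here refl)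
    ... | inj₁ refl = contradiction refl (All.lookup x∉ a∈xs)
    ... | inj₂ gx≈0 =
      ≈-trans (+-cong gx≈0 (sumK-single uniq a∈xs (others ∘ there))) (+-identityˡ _)

  module _ {Q : ℕ → ℕ → Set} (x : ℕ → Carrier) where

    vandermonde-≉0 : (∀ {a b} → Q a b → x a - x b ≉ 0#) →
                     ∀ {cs} → AllPairs Q cs → vandermonde K x cs ≉ 0#
    vandermonde-≉0 separates []           = 1≉0
    vandermonde-≉0 separates (qa ∷ pairs) =
      *-≉0 (prodK-≉0 _ (All.map separates qa)) (vandermonde-≉0 separates pairs)

    vandermonde-≈0⊎AllPairs : (∀ a b → x a - x b ≈ 0# ⊎ Q a b) →
                              ∀ cs → vandermonde K x cs ≈ 0# ⊎ AllPairs Q cs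
    vandermonde-≈0⊎AllPairs dichotomy []       = inj₂ []
    vandermonde-≈0⊎AllPairs dichotomy (a ∷ cs)
      with prodK-≈0⊎All (λ b → x a - x b) (dichotomy a) cs
         | vandermonde-≈0⊎AllPairs dichotomy cs
    ... | inj₁ head≈0 | _          = inj₁ (≈-trans (*-congʳ head≈0) (zeroˡ _))
    ... | inj₂ _      | inj₁ rest≈0 = inj₁ (≈-trans (*-congˡ rest≈0) (zeroʳ _))
    ... | inj₂ qa     | inj₂ pairs  = inj₂ (qa ∷ pairs)

    specht-≉0 : (∀ {a b} → Q a b → x a - x b ≉ 0#) →
                ∀ t → AllColumnPairs Q t → specht K t x ≉ 0#
    specht-≉0 separates t columns =
      prodK-≉0 _ (All.tabulate λ {j} j∈ → vandermonde-≉0 separates (columns j (∈-upTo⁻ j∈)))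

    specht-≈0⊎AllColumnPairs : (∀ a b → x a - x b ≈ 0# ⊎ Q a b) →
                               ∀ t → specht K t x ≈ 0# ⊎ AllColumnPairs Q t
    specht-≈0⊎AllColumnPairs dichotomy t
      with prodK-≈0⊎All _ (vandermonde-≈0⊎AllPairs dichotomy ∘ column t) (upTo (numColumns t))
    ... | inj₁ specht≈0 = inj₁ specht≈0
    ... | inj₂ columns  = inj₂ λ j j<n → All.lookup columns (∈-upTo⁺ j<n)

  fromℕ-injective : CharZero K → ∀ {m n} → fromℕ K m ≈ fromℕ K n → m ≡ n
  fromℕ-injective charZero {zero}  {zero}  _ = refl
  fromℕ-injective charZero {zero}  {suc n} 0≈1+n = ⊥-elim (charZero n (≈-sym 0≈1+n))
  fromℕ-injective charZero {suc m} {zero}  1+m≈0 = ⊥-elim (charZero m 1+m≈0)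
  fromℕ-injective charZero {suc m} {suc n} 1+m≈1+n =
    cong suc (fromℕ-injective charZero (+-Group.∙-cancelˡ 1# _ _ 1+m≈1+n))

  fromℕ-difference-≈0⊎≢ : ∀ m n → fromℕ K m - fromℕ K n ≈ 0# ⊎ m ≢ n
  fromℕ-difference-≈0⊎≢ m n with m ≟ n
  ... | yes refl = inj₁ (-‿inverseʳ (fromℕ K m))
  ... | no m≢n   = inj₂ m≢n

  fromℕ-difference-≉0 : CharZero K → ∀ {m n} → m ≢ n → fromℕ K m - fromℕ K n ≉ 0#
  fromℕ-difference-≉0 charZero m≢n =
    m≢n ∘ fromℕ-injective charZero ∘ +-Group.x∙y⁻¹≈ε⇒x≈y _ _

lemma1 : ∀ {c ℓ} (K : Field c ℓ) → CharZero K →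
         (n : ℕ) (shape : List ℕ) → IsPartition n shape →
         (ts : List Tableau) → Unique ts → (∀ t → IsStandard shape t ⇔ t ∈ ts) →
         (coef : Tableau → Field.Carrier K) →
         (f : (ℕ → Field.Carrier K) → Field.Carrier K) →
         (∀ x → Field._≈_ K (f x) (sumK K (map (λ t → Field._*_ K (coef t) (specht K t x)) ts))) →
         Σ (¬ Field._≈_ K (specht K (aleph shape) (atTableau K (aleph shape))) (Field.0# K))
           (λ nz → Field._≈_ K (coef (aleph shape))
                     (Field._*_ K (f (atTableau K (aleph shape)))
                        (Field.inv K (specht K (aleph shape) (atTableau K (aleph shape))) nz)))
lemma1 K charZero n shape partition ts unique standard⇔∈ coef f expansion =
  Δℵ≉0 , ≈*inv K coefℵΔℵ≈f Δℵ≉0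
  where
    open Field K renaming (sym to ≈-sym; trans to ≈-trans)

    ℵ : Tableau
    ℵ = aleph shape

    x : ℕ → Carrier
    x = atTableau K ℵ

    ℵ-std : IsStandard shape ℵ
    ℵ-std = aleph-standard shape

    Δℵ≉0 : specht K ℵ x ≉ 0#
    Δℵ≉0 = specht-≉0 K x (fromℕ-difference-≉0 K charZero) ℵ
                     (rowOf-separatesColumns ℵ (standard⇒Unique ℵ-std))

    only-ℵ : ∀ {t} → t ∈ ts → t ≡ ℵ ⊎ coef t * specht K t x ≈ 0#
    only-ℵ {t} t∈ts
      with specht-≈0⊎AllColumnPairs K x
             (λ a b → fromℕ-difference-≈0⊎≢ K (rowOf ℵ a) (rowOf ℵ b)) t
    ... | inj₁ Δt≈0      = inj₂ (≈-trans (*-congˡ Δt≈0) (zeroʳ (coef t)))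
    ... | inj₂ separated =
      inj₁ (standard≡aleph partition (Equivalence.from (standard⇔∈ t) t∈ts) separated)

    coefℵΔℵ≈f : coef ℵ * specht K ℵ x ≈ f x
    coefℵΔℵ≈f = ≈-sym (≈-trans (expansion x) (sumK-single K (λ t → coef t * specht K t x)
                                  unique (Equivalence.to (standard⇔∈ ℵ) ℵ-std) only-ℵ))
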